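{- Let $\mu=(\mu_1,\dots,\mu_k)\vdash n$ and $a=(a_1,\dots,a_h)\vDash n$ with $\mu\unrhd\lambda(a)$, and let $l=l(\mu,a)$. Define $\rho\vdash n-a_h$ by $\rho=\mu^{(l)}$ if $a_h=1$, and $\rho=\rho(\mu^{(l)},\tilde a)$ if $a_h\ge2$. Then $\mu/\rho$ is totally disconnected, $\rho_l<\mu_l$, and $\rho\unrhd\lambda(a')$.
   Context: A composition $a\vDash n$ is a sequence of positive integers summing to $n$; a partition $\mu\vdash n$ is a non-increasing composition, with $\mu_i=0$ beyond its parts and trailing zeros deleted. For compositions $a=(a_1,\dots,a_h)$, $b=(b_1,\dots,b_k)$ of $n$, $a\unrhd b$ means $k\ge h$ and $\sum_{i=1}^j a_i\ge\sum_{i=1}^jb_i$ for $j=1,\dots,h$. $\lambda(a)$ is the non-increasing rearrangement of $a$; $a'=(a_1,\dots,a_{h-1})$; $\tilde a=(a_1,\dots,a_{h-1},a_h-1)$ if $a_h\ge2$ and $\tilde a=(a_1,\dots,a_{h-1})$ if $a_h=1$. $\mu^{(i)}$ is $\mu$ with its $i$-th entry decreased by $1$. $R(\mu,a)$ is the set of $i\in\{1,\dots,k\}$ with $\mu_i>\mu_{i+1}$ and $\mu^{(i)}\unrhd\lambda(\tilde a)$; $l(\mu,a)=\min R(\mu,a)$. For a partition $\nu=(\nu_1,\dots,\nu_m)\vdash N$ and $b\vDash N$ with $\nu\unrhd\lambda(b)$, let $s=\max\{i:\nu_i\ge b_{h(b)}\}$ ($b_{h(b)}$ the last part of $b$) and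 $\rho(\nu,b)=(\rho_1,\dots,\rho_{m-1})$ with $\rho_i=\nu_i$ ($i<s$), $\rho_s=\nu_s-(b_{h(b)}-\nu_{s+1})$, $\rho_i=\nu_{i+1}$ ($s<i\le m-1$). For partitions $\rho=(\rho_1,\dots,\rho_h)$ and $\mu=(\mu_1,\dots,\mu_k)$ with $h\le k$ and $\rho_i\le\mu_i$, $\mu/\rho$ is totally disconnected if $\rho_i\ge\mu_{i+1}$ for all $1\le i\le h$. -}

module Defs where

open import Data.Nat using (ℕ; zero; suc; _+_; _∸_; _≤_; _<_; _≤ᵇ_; _<ᵇ_)
open import Data.Bool using (Bool; true; false; if_then_else_)
open import Data.List using (List; []; _∷_; _++_; length; take; map)
open import Data.Nat.ListAction using (sum)
open import Relation.Binary.PropositionalEquality using (_≡_)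
open import Data.List.Relation.Unary.All using (All)
open import Data.List.Relation.Unary.Linked using (Linked)
open import Data.Product using (_×_)

-- Sequences are lists of naturals; entries are 1-indexed and are 0 beyond
-- the length of the list (the paper's convention μ_i = 0 beyond its parts).
at : List ℕ → ℕ → ℕ
at []       _             = 0
at (x ∷ xs) zero          = 0
at (x ∷ xs) (suc zero)    = x
at (x ∷ xs) (suc (suc i)) = at xs (suc i)

IsComposition : List ℕ → ℕ → Set
IsComposition a n = All (0 <_) a × sum a ≡ n

IsPartition : List ℕ → ℕ → Set
IsPartition μ n = IsComposition μ n × Linked (λ x y → y ≤ x) μ

_⊵_ : List ℕ → List ℕ → Set
a ⊵ b = length a ≤ length b
      × (∀ j → 1 ≤ j → j ≤ length a → sum (take j b) ≤ sum (take j a))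

insertDesc : ℕ → List ℕ → List ℕ
insertDesc x [] = x ∷ []
insertDesc x (y ∷ ys) = if y ≤ᵇ x then x ∷ y ∷ ys else y ∷ insertDesc x ys

sortDesc : List ℕ → List ℕ
sortDesc [] = []
sortDesc (x ∷ xs) = insertDesc x (sortDesc xs)

lastPart : List ℕ → ℕ
lastPart [] = 0
lastPart (x ∷ []) = x
lastPart (x ∷ y ∷ ys) = lastPart (y ∷ ys)

initParts : List ℕ → List ℕ
initParts [] = []
initParts (x ∷ []) = []
initParts (x ∷ y ∷ ys) = x ∷ initParts (y ∷ ys)

lastDec : ℕ → List ℕ
lastDec zero = []
lastDec (suc zero) = []
lastDec (suc (suc m)) = suc m ∷ []

tilde : List ℕ → List ℕ
tilde a = initParts a ++ lastDec (lastPart a)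

isZeros : List ℕ → Bool
isZeros [] = true
isZeros (zero ∷ xs) = isZeros xs
isZeros (suc _ ∷ xs) = false

stripZeros : List ℕ → List ℕ
stripZeros [] = []
stripZeros (x ∷ xs) = if isZeros (x ∷ xs) then [] else x ∷ stripZeros xs

decAtRaw : List ℕ → ℕ → List ℕ
decAtRaw [] _ = []
decAtRaw (x ∷ xs) zero = x ∷ xs
decAtRaw (x ∷ xs) (suc zero) = (x ∸ 1) ∷ xs
decAtRaw (x ∷ xs) (suc (suc i)) = x ∷ decAtRaw xs (suc i)

decAt : List ℕ → ℕ → List ℕ
decAt μ i = stripZeros (decAtRaw μ i)

InR : List ℕ → List ℕ → ℕ → Set
InR μ a i = 1 ≤ i × i ≤ length μ × at μ (suc i) < at μ i
          × (decAt μ i ⊵ sortDesc (tilde a))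

IsMinR : List ℕ → List ℕ → ℕ → Set
IsMinR μ a l = InR μ a l × (∀ j → InR μ a j → l ≤ j)

-- s = max{ i ∈ {1,…,m} : ν_i ≥ c }  (0 if no such i)
sIdx : List ℕ → ℕ → ℕ
sIdx [] c = 0
sIdx (x ∷ xs) c with sIdx xs c
... | zero  = if c ≤ᵇ x then 1 else 0
... | suc j = suc (suc j)

range1 : ℕ → List ℕ
range1 zero = []
range1 (suc m) = range1 m ++ (suc m ∷ [])

rhoEntry : List ℕ → ℕ → ℕ → ℕ → ℕ
rhoEntry ν c s i =
  if i <ᵇ s then at ν i
  else if s <ᵇ i then at ν (suc i)
  else at ν s ∸ (c ∸ at ν (suc s))

rhoOp : List ℕ → List ℕ → List ℕ
rhoOp ν b = stripZeros (map (rhoEntry ν (lastPart b) (sIdx ν (lastPart b)))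
                            (range1 (length ν)))

rhoLemma : List ℕ → List ℕ → ℕ → List ℕ
rhoLemma μ a l with lastPart a
... | suc (suc _) = rhoOp (decAt μ l) (tilde a)
... | _           = decAt μ l

TotallyDisconnected : List ℕ → List ℕ → Set
TotallyDisconnected μ ρ =
  length ρ ≤ length μ
  × (∀ i → 1 ≤ i → i ≤ length ρ → at ρ i ≤ at μ i)
  × (∀ i → 1 ≤ i → i ≤ length ρ → at μ (suc i) ≤ at ρ i)

-- Write L = λ(a') and S_p for the sum of the first p parts. If a_h = 1 then
-- ã = a' and ρ = μ^{(l)}, and all three claims are immediate from l ∈ R(μ, a).
-- If a_h = c + 1 ≥ 2, then λ(a) and λ(ã) are L with c + 1, resp. c, inserted,
-- and S_p(ins x L) = max(S_p(L), S_{p-1}(L) + x). Minimality of l forces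
-- c < μ_l: otherwise the last j < l with μ_{j+1} ≤ c < μ_j would satisfy
-- μ^{(j)} ⊵ λ(ã), i.e. j ∈ R(μ, a). So ν = μ^{(l)} has ν_l ≥ c, whence s ≥ l,
-- and ρ = ρ(ν, ã) is ν with c cells taken from rows s and s + 1, where ν agrees
-- with μ; this gives total disconnectedness and ρ_l ≤ ν_l < μ_l. Finally
-- S_p(ρ) is S_p(ν) for p < s and S_{p+1}(ν) − c for p ≥ s, which dominates
-- S_p(L) by the insertion formula; as |ρ| = |L|, ρ has no parts beyond ℓ(L).

module Submission where

open import Defs
open import Data.Nat
open import Data.Nat.Properties
open import Data.Bool using (true; false)
open import Data.List using (List; []; _∷_; _++_; length; take; map)
open import Data.List.Properties using (length-++; ++-identityʳ; map-++)
open import Data.Nat.ListAction using (sum)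
open import Data.List.Relation.Unary.Linked using (Linked; []; [-]; _∷_; tail)
open import Data.Product using (_×_; _,_; proj₁; proj₂; ∃-syntax)
open import Data.Sum using (_⊎_; inj₁; inj₂)
open import Data.Empty using (⊥-elim)
open import Function using (_∘_)
open import Relation.Nullary using (yes; no)
open import Relation.Nullary.Reflects using (ofʸ; ofⁿ)
open import Relation.Binary.PropositionalEquality
open import Relation.Binary.Definitions using (tri<; tri≈; tri>)
open import Algebra.Properties.CommutativeSemigroup +-commutativeSemigroup using (x∙yz≈y∙xz; xy∙z≈xz∙y)

Descending : List ℕ → Set
Descending = Linked (λ x y → y ≤ x)

insertDesc-here : ∀ {x y} ys → y ≤ x → insertDesc x (y ∷ ys) ≡ x ∷ y ∷ ys
insertDesc-here {x} {y} ys y≤x with y ≤ᵇ x | ≤ᵇ-reflects-≤ y x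
... | true  | _       = refl
... | false | ofⁿ y≰x = ⊥-elim (y≰x y≤x)

insertDesc-there : ∀ {x y} ys → x < y → insertDesc x (y ∷ ys) ≡ y ∷ insertDesc x ys
insertDesc-there {x} {y} ys x<y with y ≤ᵇ x | ≤ᵇ-reflects-≤ y x
... | true  | ofʸ y≤x = ⊥-elim (<⇒≱ x<y y≤x)
... | false | _       = refl

insertDesc-comm-< : ∀ {x y} → y < x → ∀ L →
  insertDesc x (insertDesc y L) ≡ insertDesc y (insertDesc x L)
insertDesc-comm-< y<x [] rewrite insertDesc-here [] (<⇒≤ y<x) | insertDesc-there [] y<x = refl
insertDesc-comm-< {x} {y} y<x (z ∷ zs) with ≤-<-connex z y | ≤-<-connex z x
... | inj₁ z≤y | _
  rewrite insertDesc-here zs z≤y | insertDesc-here (z ∷ zs) (<⇒≤ y<x)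
        | insertDesc-here zs (≤-trans z≤y (<⇒≤ y<x)) | insertDesc-there (z ∷ zs) y<x
        | insertDesc-here zs z≤y = refl
... | inj₂ y<z | inj₁ z≤x
  rewrite insertDesc-there zs y<z | insertDesc-here (insertDesc y zs) z≤x
        | insertDesc-here zs z≤x | insertDesc-there (z ∷ zs) y<x
        | insertDesc-there zs y<z = refl
... | inj₂ y<z | inj₂ x<z
  rewrite insertDesc-there zs y<z | insertDesc-there (insertDesc y zs) x<z
        | insertDesc-there zs x<z | insertDesc-there (insertDesc x zs) y<z
        | insertDesc-comm-< y<x zs = refl

insertDesc-comm : ∀ x y L → insertDesc x (insertDesc y L) ≡ insertDesc y (insertDesc x L)
insertDesc-comm x y L with <-cmp x y
... | tri< x<y _ _    = sym (insertDesc-comm-< x<y L)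
... | tri≈ _ refl _   = refl
... | tri> _ _ y<x    = insertDesc-comm-< y<x L

sortDesc-∷ʳ : ∀ xs y → sortDesc (xs ++ y ∷ []) ≡ insertDesc y (sortDesc xs)
sortDesc-∷ʳ []       y = refl
sortDesc-∷ʳ (x ∷ xs) y rewrite sortDesc-∷ʳ xs y = insertDesc-comm x y (sortDesc xs)

insertDesc-below-head : ∀ {x y} ys → Descending (y ∷ ys) → x ≤ y →
  Descending (y ∷ insertDesc x ys)
insertDesc-below-head []       _           x≤y = x≤y ∷ [-]
insertDesc-below-head {x} (z ∷ zs) (z≤y ∷ d) x≤y with ≤-<-connex z x
... | inj₁ z≤x rewrite insertDesc-here zs z≤x  = x≤y ∷ z≤x ∷ d
... | inj₂ x<z rewrite insertDesc-there zs x<z = z≤y ∷ insertDesc-below-head zs d (<⇒≤ x<z)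

insertDesc-descending : ∀ x L → Descending L → Descending (insertDesc x L)
insertDesc-descending x []       _ = [-]
insertDesc-descending x (y ∷ ys) d with ≤-<-connex y x
... | inj₁ y≤x rewrite insertDesc-here ys y≤x  = y≤x ∷ d
... | inj₂ x<y rewrite insertDesc-there ys x<y = insertDesc-below-head ys d (<⇒≤ x<y)

sortDesc-descending : ∀ xs → Descending (sortDesc xs)
sortDesc-descending []       = []
sortDesc-descending (x ∷ xs) = insertDesc-descending x (sortDesc xs) (sortDesc-descending xs)

sum-insertDesc : ∀ x L → sum (insertDesc x L) ≡ x + sum L
sum-insertDesc x []       = refl
sum-insertDesc x (y ∷ ys) with ≤-<-connex y x
... | inj₁ y≤x rewrite insertDesc-here ys y≤x = refl
... | inj₂ x<y rewrite insertDesc-there ys x<y | sum-insertDesc x ys = x∙yz≈y∙xz y x (sum ys)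

length-insertDesc : ∀ x L → length (insertDesc x L) ≡ suc (length L)
length-insertDesc x []       = refl
length-insertDesc x (y ∷ ys) with ≤-<-connex y x
... | inj₁ y≤x rewrite insertDesc-here ys y≤x = refl
... | inj₂ x<y rewrite insertDesc-there ys x<y | length-insertDesc x ys = refl

sum-sortDesc : ∀ xs → sum (sortDesc xs) ≡ sum xs
sum-sortDesc []       = refl
sum-sortDesc (x ∷ xs) rewrite sum-insertDesc x (sortDesc xs) | sum-sortDesc xs = refl

at-beyond : ∀ xs {i} → length xs < i → at xs i ≡ 0
at-beyond []       _               = refl
at-beyond (x ∷ xs) {suc (suc i)} (s≤s lt) = at-beyond xs lt

at-pos⇒index : ∀ xs {i} → 0 < at xs i → 1 ≤ i × i ≤ length xs
at-pos⇒index (x ∷ xs) {suc zero}    _   = s≤s z≤n , s≤s z≤n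
at-pos⇒index (x ∷ xs) {suc (suc i)} pos with at-pos⇒index xs {suc i} pos
... | _ , i≤ = s≤s z≤n , s≤s i≤

at-antitone-step : ∀ {xs} → Descending xs → ∀ i → at xs (suc (suc i)) ≤ at xs (suc i)
at-antitone-step []              _       = z≤n
at-antitone-step [-]             _       = z≤n
at-antitone-step (y≤x ∷ _)       zero    = y≤x
at-antitone-step (_   ∷ d)       (suc i) = at-antitone-step d i

at-antitone : ∀ {xs} → Descending xs → ∀ {i j} → i ≤ j → at xs (suc j) ≤ at xs (suc i)
at-antitone d {j = zero}  z≤n = ≤-refl
at-antitone d {i} {suc j} i≤ with m≤n⇒m<n∨m≡n i≤
... | inj₂ refl        = ≤-refl
... | inj₁ (s≤s i≤j)   = ≤-trans (at-antitone-step d j) (at-antitone d i≤j)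

psum : (ℕ → ℕ) → ℕ → ℕ
psum f zero    = 0
psum f (suc p) = psum f p + f (suc p)

psum-cong : ∀ {f g} p → (∀ i → i < p → f (suc i) ≡ g (suc i)) → psum f p ≡ psum g p
psum-cong zero    _  = refl
psum-cong (suc p) eq = cong₂ _+_ (psum-cong p (λ i i<p → eq i (m<n⇒m<1+n i<p))) (eq p ≤-refl)

psum-mono : ∀ f {p q} → p ≤ q → psum f p ≤ psum f q
psum-mono f {q = zero}  z≤n = ≤-refl
psum-mono f {p} {suc q} p≤ with m≤n⇒m<n∨m≡n p≤
... | inj₂ refl      = ≤-refl
... | inj₁ (s≤s p≤q) = ≤-trans (psum-mono f p≤q) (m≤m+n _ _)

psum-+-≤ : ∀ f {p i} → p < i → psum f p + f i ≤ psum f i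
psum-+-≤ f {i = suc i} (s≤s p≤i) = +-monoˡ-≤ (f (suc i)) (psum-mono f p≤i)

psum-at-[] : ∀ p → psum (at []) p ≡ 0
psum-at-[] zero    = refl
psum-at-[] (suc p) = cong (_+ 0) (psum-at-[] p)

psum-at-∷ : ∀ x xs p → psum (at (x ∷ xs)) (suc p) ≡ x + psum (at xs) p
psum-at-∷ x xs zero    = +-comm 0 x
psum-at-∷ x xs (suc p) = trans (cong (_+ at xs (suc p)) (psum-at-∷ x xs p)) (+-assoc x _ _)

sum-take≡psum-at : ∀ xs p → sum (take p xs) ≡ psum (at xs) p
sum-take≡psum-at []       zero    = refl
sum-take≡psum-at []       (suc p) = sym (psum-at-[] (suc p))
sum-take≡psum-at (x ∷ xs) zero    = refl
sum-take≡psum-at (x ∷ xs) (suc p) = trans (cong (x +_) (sum-take≡psum-at xs p)) (sym (psum-at-∷ x xs p))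

psum-at-≤-sum : ∀ xs p → psum (at xs) p ≤ sum xs
psum-at-≤-sum []       p       = ≤-reflexive (psum-at-[] p)
psum-at-≤-sum (x ∷ xs) zero    = z≤n
psum-at-≤-sum (x ∷ xs) (suc p) = ≤-trans (≤-reflexive (psum-at-∷ x xs p)) (+-monoʳ-≤ x (psum-at-≤-sum xs p))

psum-at-length : ∀ xs {p} → length xs ≤ p → psum (at xs) p ≡ sum xs
psum-at-length []       {p}     _        = psum-at-[] p
psum-at-length (x ∷ xs) {suc p} (s≤s le) = trans (psum-at-∷ x xs p) (cong (x +_) (psum-at-length xs le))

⊵⇒psum-at-≤ : ∀ {a b} → a ⊵ b → sum b ≤ sum a → ∀ p → psum (at b) p ≤ psum (at a) p
⊵⇒psum-at-≤             _         _     zero    = z≤n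
⊵⇒psum-at-≤ {a} {b} (_ , dom) sum≤ (suc p) with suc p ≤? length a
... | yes p<len = subst₂ _≤_ (sum-take≡psum-at b (suc p)) (sum-take≡psum-at a (suc p))
                    (dom (suc p) (s≤s z≤n) p<len)
... | no  p≮len = begin
  psum (at b) (suc p) ≤⟨ psum-at-≤-sum b (suc p) ⟩
  sum b               ≤⟨ sum≤ ⟩
  sum a               ≡⟨ psum-at-length a (<⇒≤ (≰⇒> p≮len)) ⟨
  psum (at a) (suc p) ∎
  where open ≤-Reasoning

psum-at-≤⇒⊵ : ∀ {a b} → length a ≤ length b → (∀ p → psum (at b) p ≤ psum (at a) p) → a ⊵ b
psum-at-≤⇒⊵ {a} {b} len≤ dom = len≤ , λ j _ _ →
  subst₂ _≤_ (sym (sum-take≡psum-at b j)) (sym (sum-take≡psum-at a j)) (dom j)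

-- The p largest parts of L ∪ {x} are either the p largest parts of L, or x
-- together with the p − 1 largest parts of L.
psum-insertDesc : ∀ x {L} → Descending L → ∀ q →
  psum (at (insertDesc x L)) (suc q) ≡ psum (at L) (suc q) ⊔ (psum (at L) q + x)
psum-insertDesc x {[]} _ q rewrite psum-at-∷ x [] q | psum-at-[] q = +-identityʳ x
psum-insertDesc x {y ∷ ys} d q with ≤-<-connex y x
... | inj₁ y≤x rewrite insertDesc-here ys y≤x = begin
  psum (at (x ∷ y ∷ ys)) (suc q)     ≡⟨ psum-at-∷ x (y ∷ ys) q ⟩
  x + P q                            ≡⟨ +-comm x (P q) ⟩
  P q + x                            ≡⟨ m≤n⇒m⊔n≡n (+-monoʳ-≤ (P q) next≤x) ⟨
  P (suc q) ⊔ (P q + x)              ∎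
  where
  open ≡-Reasoning
  P = psum (at (y ∷ ys))
  next≤x : at (y ∷ ys) (suc q) ≤ x
  next≤x = ≤-trans (at-antitone d {j = q} z≤n) y≤x
... | inj₂ x<y rewrite insertDesc-there ys x<y with q
...   | zero   = sym (m≥n⇒m⊔n≡m (<⇒≤ x<y))
...   | suc q' = begin
  psum (at (y ∷ insertDesc x ys)) (suc (suc q'))        ≡⟨ psum-at-∷ y _ (suc q') ⟩
  y + psum (at (insertDesc x ys)) (suc q')              ≡⟨ cong (y +_) (psum-insertDesc x (tail d) q') ⟩
  y + (psum (at ys) (suc q') ⊔ (psum (at ys) q' + x))   ≡⟨ +-distribˡ-⊔ y _ _ ⟩
  (y + psum (at ys) (suc q')) ⊔ (y + (psum (at ys) q' + x))
    ≡⟨ cong₂ _⊔_ (psum-at-∷ y ys (suc q')) (trans (cong (_+ x) (psum-at-∷ y ys q')) (+-assoc y _ x)) ⟨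
  psum (at (y ∷ ys)) (suc (suc q')) ⊔ (psum (at (y ∷ ys)) (suc q') + x) ∎
  where open ≡-Reasoning

module _ {L : List ℕ} (L-desc : Descending L) where

  psum-≤-psum-insertDesc : ∀ x p → psum (at L) p ≤ psum (at (insertDesc x L)) p
  psum-≤-psum-insertDesc x zero    = z≤n
  psum-≤-psum-insertDesc x (suc q) rewrite psum-insertDesc x L-desc q = m≤m⊔n _ _

  psum-+-≤-psum-insertDesc : ∀ x p → psum (at L) p + x ≤ psum (at (insertDesc x L)) (suc p)
  psum-+-≤-psum-insertDesc x p rewrite psum-insertDesc x L-desc p = m≤n⊔m _ _

  psum-insertDesc-monoˡ : ∀ x p → psum (at (insertDesc x L)) p ≤ psum (at (insertDesc (suc x) L)) p
  psum-insertDesc-monoˡ x zero = z≤n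
  psum-insertDesc-monoˡ x (suc q)
    rewrite psum-insertDesc x L-desc q | psum-insertDesc (suc x) L-desc q =
    ⊔-monoʳ-≤ (psum (at L) (suc q)) (+-monoʳ-≤ (psum (at L) q) (n≤1+n x))

  psum-insertDesc-suc : ∀ x p →
    psum (at (insertDesc x L)) p < psum (at (insertDesc (suc x) L)) p
    ⊎ psum (at (insertDesc x L)) p + x < psum (at (insertDesc (suc x) L)) (suc p)
  psum-insertDesc-suc x zero = inj₂ (psum-+-≤-psum-insertDesc (suc x) zero)
  psum-insertDesc-suc x (suc q) with ≤-<-connex (psum (at L) (suc q)) (psum (at L) q + x)
  ... | inj₁ A≤B+x = inj₁ (begin-strict
    psum (at (insertDesc x L)) (suc q)             ≡⟨ psum-insertDesc x L-desc q ⟩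
    psum (at L) (suc q) ⊔ (psum (at L) q + x)      ≡⟨ m≤n⇒m⊔n≡n A≤B+x ⟩
    psum (at L) q + x                              <⟨ +-monoʳ-< (psum (at L) q) (n<1+n x) ⟩
    psum (at L) q + suc x                          ≤⟨ m≤n⊔m _ _ ⟩
    psum (at L) (suc q) ⊔ (psum (at L) q + suc x)  ≡⟨ psum-insertDesc (suc x) L-desc q ⟨
    psum (at (insertDesc (suc x) L)) (suc q)       ∎)
    where open ≤-Reasoning
  ... | inj₂ B+x<A = inj₂ (begin-strict
    psum (at (insertDesc x L)) (suc q) + x             ≡⟨ cong (_+ x) (psum-insertDesc x L-desc q) ⟩
    psum (at L) (suc q) ⊔ (psum (at L) q + x) + x      ≡⟨ cong (_+ x) (m≥n⇒m⊔n≡m (<⇒≤ B+x<A)) ⟩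
    psum (at L) (suc q) + x                            <⟨ +-monoʳ-< (psum (at L) (suc q)) (n<1+n x) ⟩
    psum (at L) (suc q) + suc x                        ≤⟨ psum-+-≤-psum-insertDesc (suc x) (suc q) ⟩
    psum (at (insertDesc (suc x) L)) (suc (suc q))     ∎)
    where open ≤-Reasoning

  psum-insertDesc-<-psum : ∀ {x f p} → (∀ q → psum (at (insertDesc (suc x) L)) q ≤ psum f q) →
    f (suc p) ≤ x → psum (at (insertDesc x L)) p < psum f p
  psum-insertDesc-<-psum {x} {f} {p} dom f≤x with psum-insertDesc-suc x p
  ... | inj₁ lt = <-≤-trans lt (dom p)
  ... | inj₂ lt = +-cancelʳ-< x _ _ (begin-strict
    psum (at (insertDesc x L)) p + x              <⟨ lt ⟩
    psum (at (insertDesc (suc x) L)) (suc p)      ≤⟨ dom (suc p) ⟩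
    psum f p + f (suc p)                          ≤⟨ +-monoʳ-≤ (psum f p) f≤x ⟩
    psum f p + x                                  ∎)
    where open ≤-Reasoning

isZeros⇒at≡0 : ∀ xs i → isZeros xs ≡ true → at xs i ≡ 0
isZeros⇒at≡0 []           _             _  = refl
isZeros⇒at≡0 (zero ∷ xs) zero          _  = refl
isZeros⇒at≡0 (zero ∷ xs) (suc zero)    _  = refl
isZeros⇒at≡0 (zero ∷ xs) (suc (suc i)) eq = isZeros⇒at≡0 xs (suc i) eq

at≡0⇒isZeros : ∀ xs → (∀ i → 0 < i → at xs i ≡ 0) → isZeros xs ≡ true
at≡0⇒isZeros []          _    = refl
at≡0⇒isZeros (zero ∷ xs)  at≡0 = at≡0⇒isZeros xs (λ { (suc i) _ → at≡0 (suc (suc i)) (s≤s z≤n) })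
at≡0⇒isZeros (suc x ∷ xs) at≡0 with () ← at≡0 1 (s≤s z≤n)

at-stripZeros : ∀ xs i → at (stripZeros xs) i ≡ at xs i
at-stripZeros []       _ = refl
at-stripZeros (x ∷ xs) i with isZeros (x ∷ xs) in eq
... | true = sym (isZeros⇒at≡0 (x ∷ xs) i eq)
... | false with i
...   | zero          = refl
...   | suc zero      = refl
...   | suc (suc i′)  = at-stripZeros xs (suc i′)

length-stripZeros : ∀ xs → length (stripZeros xs) ≤ length xs
length-stripZeros []       = z≤n
length-stripZeros (x ∷ xs) with isZeros (x ∷ xs)
... | true  = z≤n
... | false = s≤s (length-stripZeros xs)

length-stripZeros-≤ : ∀ xs q → (∀ i → q < i → at xs i ≡ 0) → length (stripZeros xs) ≤ q
length-stripZeros-≤ []       _ _    = z≤n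
length-stripZeros-≤ (x ∷ xs) q at≡0 with isZeros (x ∷ xs) in eq
... | true = z≤n
... | false with q
...   | zero with () ← trans (sym eq) (at≡0⇒isZeros (x ∷ xs) at≡0)
...   | suc q′ = s≤s (length-stripZeros-≤ xs q′
                   (λ { (suc i) (s≤s q′<i) → at≡0 (suc (suc i)) (s≤s (s≤s q′<i)) }))

at-decAtRaw-self : ∀ xs l → at (decAtRaw xs (suc l)) (suc l) ≡ at xs (suc l) ∸ 1
at-decAtRaw-self []       _       = refl
at-decAtRaw-self (x ∷ xs) zero    = refl
at-decAtRaw-self (x ∷ xs) (suc l) = at-decAtRaw-self xs l

at-decAtRaw-other : ∀ xs l i → i ≢ suc l → at (decAtRaw xs (suc l)) i ≡ at xs i
at-decAtRaw-other []       _       _             _   = refl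
at-decAtRaw-other (x ∷ xs) zero    zero          _   = refl
at-decAtRaw-other (x ∷ xs) (suc l) zero          _   = refl
at-decAtRaw-other (x ∷ xs) zero    (suc zero)    i≢  = ⊥-elim (i≢ refl)
at-decAtRaw-other (x ∷ xs) zero    (suc (suc i)) _   = refl
at-decAtRaw-other (x ∷ xs) (suc l) (suc zero)    _   = refl
at-decAtRaw-other (x ∷ xs) (suc l) (suc (suc i)) i≢  = at-decAtRaw-other xs l (suc i) (i≢ ∘ cong suc)

length-decAtRaw : ∀ xs l → length (decAtRaw xs l) ≡ length xs
length-decAtRaw []       _             = refl
length-decAtRaw (x ∷ xs) zero          = refl
length-decAtRaw (x ∷ xs) (suc zero)    = refl
length-decAtRaw (x ∷ xs) (suc (suc l)) = cong suc (length-decAtRaw xs (suc l))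

<⇒≤∸1 : ∀ {m n} → m < n → m ≤ n ∸ 1
<⇒≤∸1 (s≤s m≤n) = m≤n

module _ (xs : List ℕ) (l : ℕ) where

  at-decAt-self : at (decAt xs (suc l)) (suc l) ≡ at xs (suc l) ∸ 1
  at-decAt-self = trans (at-stripZeros (decAtRaw xs (suc l)) (suc l)) (at-decAtRaw-self xs l)

  at-decAt-other : ∀ {i} → i ≢ suc l → at (decAt xs (suc l)) i ≡ at xs i
  at-decAt-other {i} i≢ = trans (at-stripZeros (decAtRaw xs (suc l)) i) (at-decAtRaw-other xs l i i≢)

  at-decAt-≤ : ∀ i → at (decAt xs (suc l)) i ≤ at xs i
  at-decAt-≤ i with i ≟ suc l
  ... | yes refl = ≤-trans (≤-reflexive at-decAt-self) (m∸n≤m _ 1)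
  ... | no  i≢   = ≤-reflexive (at-decAt-other i≢)

  at-decAt-< : 0 < at xs (suc l) → at (decAt xs (suc l)) (suc l) < at xs (suc l)
  at-decAt-< pos rewrite at-decAt-self = ∸-monoʳ-< {o = 0} (s≤s z≤n) pos

  length-decAt-≤ : length (decAt xs (suc l)) ≤ length xs
  length-decAt-≤ = ≤-trans (length-stripZeros (decAtRaw xs (suc l))) (≤-reflexive (length-decAtRaw xs (suc l)))

  psum-decAt-≤ : ∀ {p} → p ≤ l → psum (at (decAt xs (suc l))) p ≡ psum (at xs) p
  psum-decAt-≤ p≤l = psum-cong _ (λ i i<p → at-decAt-other (<⇒≢ (s≤s (<-≤-trans i<p p≤l))))

  psum-decAt-> : 0 < at xs (suc l) → ∀ {p} → l < p →
    psum (at (decAt xs (suc l))) p + 1 ≡ psum (at xs) p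
  psum-decAt-> pos {suc p} (s≤s l≤p) with m≤n⇒m<n∨m≡n l≤p
  ... | inj₂ refl = begin
    psum (at ν) l + at ν (suc l) + 1           ≡⟨ +-assoc (psum (at ν) l) _ 1 ⟩
    psum (at ν) l + (at ν (suc l) + 1)         ≡⟨ cong₂ _+_ (psum-decAt-≤ ≤-refl) (cong (_+ 1) at-decAt-self) ⟩
    psum (at xs) l + (at xs (suc l) ∸ 1 + 1)   ≡⟨ cong (psum (at xs) l +_) (m∸n+n≡m pos) ⟩
    psum (at xs) l + at xs (suc l)             ∎
    where open ≡-Reasoning
          ν = decAt xs (suc l)
  ... | inj₁ l<p = begin
    psum (at ν) p + at ν (suc p) + 1           ≡⟨ xy∙z≈xz∙y (psum (at ν) p) _ 1 ⟩
    psum (at ν) p + 1 + at ν (suc p)           ≡⟨ cong₂ _+_ (psum-decAt-> pos l<p) (at-decAt-other (<⇒≢ (s≤s l<p) ∘ sym)) ⟩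
    psum (at xs) p + at xs (suc p)             ∎
    where open ≡-Reasoning
          ν = decAt xs (suc l)

  sum-decAt : 0 < at xs (suc l) → sum (decAt xs (suc l)) + 1 ≡ sum xs
  sum-decAt pos = begin
    sum (decAt xs (suc l)) + 1                   ≡⟨ cong (_+ 1) (psum-at-length (decAt xs (suc l)) length-decAt-≤) ⟨
    psum (at (decAt xs (suc l))) (length xs) + 1 ≡⟨ psum-decAt-> pos (proj₂ (at-pos⇒index xs pos)) ⟩
    psum (at xs) (length xs)                     ≡⟨ psum-at-length xs ≤-refl ⟩
    sum xs                                       ∎
    where open ≡-Reasoning

  at-decAt-lower : Descending xs → at xs (suc (suc l)) < at xs (suc l) →
    ∀ i → at xs (suc (suc i)) ≤ at (decAt xs (suc l)) (suc i)
  at-decAt-lower d step i with suc i ≟ suc l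
  ... | yes refl = subst (at xs (suc (suc i)) ≤_) (sym at-decAt-self) (<⇒≤∸1 step)
  ... | no  i≢   = subst (at xs (suc (suc i)) ≤_) (sym (at-decAt-other i≢)) (at-antitone-step d i)

  decAt-totallyDisconnected : Descending xs → at xs (suc (suc l)) < at xs (suc l) →
    TotallyDisconnected xs (decAt xs (suc l))
  decAt-totallyDisconnected d step =
    length-decAt-≤ , (λ i _ _ → at-decAt-≤ i) , λ { (suc i) _ _ → at-decAt-lower d step i }

at-++ˡ : ∀ xs ys {i} → i ≤ length xs → at (xs ++ ys) i ≡ at xs i
at-++ˡ []       []       {zero}        _        = refl
at-++ˡ []       (_ ∷ _)  {zero}        _        = refl
at-++ˡ (x ∷ xs) ys       {zero}        _        = refl
at-++ˡ (x ∷ xs) ys       {suc zero}    _        = refl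
at-++ˡ (x ∷ xs) ys       {suc (suc i)} (s≤s i≤) = at-++ˡ xs ys i≤

at-++-∷ : ∀ xs y ys → at (xs ++ y ∷ ys) (suc (length xs)) ≡ y
at-++-∷ []       y ys = refl
at-++-∷ (x ∷ xs) y ys = at-++-∷ xs y ys

length-map-range1 : ∀ (F : ℕ → ℕ) m → length (map F (range1 m)) ≡ m
length-map-range1 F zero    = refl
length-map-range1 F (suc m) rewrite map-++ F (range1 m) (suc m ∷ [])
                                  | length-++ (map F (range1 m)) {F (suc m) ∷ []}
                                  | length-map-range1 F m = +-comm m 1

at-map-range1 : ∀ (F : ℕ → ℕ) m {i} → 1 ≤ i → i ≤ m → at (map F (range1 m)) i ≡ F i
at-map-range1 F zero    (s≤s _) ()
at-map-range1 F (suc m) {i} 1≤i i≤ rewrite map-++ F (range1 m) (suc m ∷ []) with m≤n⇒m<n∨m≡n i≤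
... | inj₂ refl = subst (λ k → at (map F (range1 m) ++ F (suc m) ∷ []) (suc k) ≡ F (suc m))
                        (length-map-range1 F m) (at-++-∷ (map F (range1 m)) (F (suc m)) [])
... | inj₁ (s≤s i≤m) = trans (at-++ˡ (map F (range1 m)) _ (subst (i ≤_) (sym (length-map-range1 F m)) i≤m))
                             (at-map-range1 F m 1≤i i≤m)

module _ (ν : List ℕ) (c s : ℕ) where

  rhoEntry-< : ∀ {i} → i < s → rhoEntry ν c s i ≡ at ν i
  rhoEntry-< {i} i<s with i <ᵇ s | <ᵇ-reflects-< i s
  ... | true  | _       = refl
  ... | false | ofⁿ i≮s = ⊥-elim (i≮s i<s)

  rhoEntry-> : ∀ {i} → s < i → rhoEntry ν c s i ≡ at ν (suc i)
  rhoEntry-> {i} s<i with i <ᵇ s | <ᵇ-reflects-< i s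
  ... | true  | ofʸ i<s = ⊥-elim (<-asym i<s s<i)
  ... | false | _ with s <ᵇ i | <ᵇ-reflects-< s i
  ...   | true  | _       = refl
  ...   | false | ofⁿ s≮i = ⊥-elim (s≮i s<i)

  rhoEntry-self : rhoEntry ν c s s ≡ at ν s ∸ (c ∸ at ν (suc s))
  rhoEntry-self with s <ᵇ s | <ᵇ-reflects-< s s
  ... | true  | ofʸ s<s′ = ⊥-elim (<-irrefl refl s<s′)
  ... | false | _       = refl

sIdx-≤-length : ∀ ν c → sIdx ν c ≤ length ν
sIdx-≤-length []       c = z≤n
sIdx-≤-length (x ∷ xs) c with sIdx xs c | sIdx-≤-length xs c
... | suc j | j<len = s≤s j<len
... | zero  | _ with c ≤ᵇ x
...   | true  = s≤s z≤n
...   | false = z≤n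

≤-at-sIdx : ∀ ν c → 1 ≤ sIdx ν c → c ≤ at ν (sIdx ν c)
≤-at-sIdx (x ∷ xs) c 1≤s with sIdx xs c | ≤-at-sIdx xs c
... | suc j | c≤ = c≤ (s≤s z≤n)
... | zero  | _ with c ≤ᵇ x | ≤ᵇ-reflects-≤ c x
...   | true  | ofʸ c≤x = c≤x
...   | false | _ with () ← 1≤s

at-<-beyond-sIdx : ∀ ν c → 0 < c → ∀ {i} → sIdx ν c < i → at ν i < c
at-<-beyond-sIdx []       c 0<c _ = 0<c
at-<-beyond-sIdx (x ∷ xs) c 0<c {i} s<i with sIdx xs c | at-<-beyond-sIdx xs c 0<c
... | suc j | beyond with i | s<i
...   | suc (suc i′) | s≤s s<i′ = beyond s<i′
at-<-beyond-sIdx (x ∷ xs) c 0<c {i} s<i | zero | beyond with c ≤ᵇ x | ≤ᵇ-reflects-≤ c x | i | s<i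
... | true  | _       | suc zero     | s≤s ()
... | true  | _       | suc (suc i′) | _ = beyond (s≤s z≤n)
... | false | ofⁿ c≰x | suc zero     | _ = ≰⇒> c≰x
... | false | _       | suc (suc i′) | _ = beyond (s≤s z≤n)

module _ (ν b : List ℕ) where

  private
    F : ℕ → ℕ
    F = rhoEntry ν (lastPart b) (sIdx ν (lastPart b))
    entries = map F (range1 (length ν))

  at-rhoOp : ∀ {i} → 1 ≤ i → at (rhoOp ν b) i ≡ F i
  at-rhoOp {i} 1≤i with i ≤? length ν
  ... | yes i≤ = trans (at-stripZeros entries i) (at-map-range1 F (length ν) 1≤i i≤)
  ... | no  i≰ = begin
    at (rhoOp ν b) i                     ≡⟨ at-stripZeros entries i ⟩
    at entries i                         ≡⟨ at-beyond entries (subst (_< i) (sym (length-map-range1 F (length ν))) (≰⇒> i≰)) ⟩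
    0                                    ≡⟨ at-beyond ν (m<n⇒m<1+n (≰⇒> i≰)) ⟨
    at ν (suc i)                         ≡⟨ rhoEntry-> ν _ _ (≤-<-trans (sIdx-≤-length ν _) (≰⇒> i≰)) ⟨
    F i                                  ∎
    where open ≡-Reasoning

  length-rhoOp-≤ : length (rhoOp ν b) ≤ length ν
  length-rhoOp-≤ = ≤-trans (length-stripZeros entries) (≤-reflexive (length-map-range1 F (length ν)))

  length-rhoOp-≤-vanish : ∀ q → (∀ i → q < i → at (rhoOp ν b) i ≡ 0) → length (rhoOp ν b) ≤ q
  length-rhoOp-≤-vanish q at≡0 =
    length-stripZeros-≤ entries q (λ i q<i → trans (sym (at-stripZeros entries i)) (at≡0 i q<i))

-- With c the last part of b and the row index `suc s`, ρ(ν, b) shortens that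
-- row by c − ν_{s+2} and deletes the row below it: c cells in all.
module _ (ν : List ℕ) {c s : ℕ} (c≤ν : c ≤ at ν (suc s)) (ν≤c : at ν (suc (suc s)) ≤ c) where

  private
    r : ℕ → ℕ
    r = rhoEntry ν c (suc s)

  rhoEntry-self-≤ : r (suc s) ≤ at ν (suc s)
  rhoEntry-self-≤ = ≤-trans (≤-reflexive (rhoEntry-self ν c (suc s))) (m∸n≤m _ (c ∸ at ν (suc (suc s))))

  ≤-rhoEntry-self : at ν (suc (suc s)) ≤ r (suc s)
  ≤-rhoEntry-self = begin
    at ν (suc (suc s))                              ≡⟨ m∸[m∸n]≡n ν≤c ⟨
    c ∸ (c ∸ at ν (suc (suc s)))                    ≤⟨ ∸-monoˡ-≤ (c ∸ at ν (suc (suc s))) c≤ν ⟩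
    at ν (suc s) ∸ (c ∸ at ν (suc (suc s)))         ≡⟨ rhoEntry-self ν c (suc s) ⟨
    r (suc s)                                       ∎
    where open ≤-Reasoning

  psum-rhoEntry-≤ : ∀ {p} → p ≤ s → psum r p ≡ psum (at ν) p
  psum-rhoEntry-≤ p≤s = psum-cong _ (λ i i<p → rhoEntry-< ν c (suc s) (s≤s (≤-trans i<p p≤s)))

  psum-rhoEntry-> : ∀ {p} → s < p → psum r p + c ≡ psum (at ν) (suc p)
  psum-rhoEntry-> {suc p} (s≤s s≤p) with m≤n⇒m<n∨m≡n s≤p
  ... | inj₂ refl = begin
    psum r s + r (suc s) + c                  ≡⟨ +-assoc (psum r s) _ c ⟩
    psum r s + (r (suc s) + c)                ≡⟨ cong₂ _+_ (psum-rhoEntry-≤ ≤-refl) removed-cell ⟩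
    psum (at ν) s + (x + y)                   ≡⟨ +-assoc (psum (at ν) s) x y ⟨
    psum (at ν) s + x + y                     ∎
    where
    open ≡-Reasoning
    x = at ν (suc s)
    y = at ν (suc (suc s))
    removed-cell : r (suc s) + c ≡ x + y
    removed-cell = begin
      r (suc s) + c                  ≡⟨ cong (_+ c) (rhoEntry-self ν c (suc s)) ⟩
      x ∸ (c ∸ y) + c                ≡⟨ cong (x ∸ (c ∸ y) +_) (m∸n+n≡m ν≤c) ⟨
      x ∸ (c ∸ y) + ((c ∸ y) + y)    ≡⟨ +-assoc (x ∸ (c ∸ y)) (c ∸ y) y ⟨
      x ∸ (c ∸ y) + (c ∸ y) + y      ≡⟨ cong (_+ y) (m∸n+n≡m (≤-trans (m∸n≤m c y) c≤ν)) ⟩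
      x + y                          ∎
  ... | inj₁ s<p = begin
    psum r p + r (suc p) + c                      ≡⟨ xy∙z≈xz∙y (psum r p) _ c ⟩
    psum r p + c + r (suc p)                      ≡⟨ cong₂ _+_ (psum-rhoEntry-> s<p) (rhoEntry-> ν c (suc s) (s≤s s<p)) ⟩
    psum (at ν) (suc p) + at ν (suc (suc p))      ∎
    where open ≡-Reasoning

psum-dominated-vanish : ∀ L f → (∀ p → psum (at L) p ≤ psum f p) → (∀ p → psum f p ≤ sum L) →
  ∀ {i} → length L < i → f i ≡ 0
psum-dominated-vanish L f dom bound {i} len<i = n≤0⇒n≡0 (+-cancelˡ-≤ (sum L) (f i) 0 (begin
  sum L + f i                    ≡⟨ cong (_+ f i) (psum-at-length L ≤-refl) ⟨
  psum (at L) (length L) + f i   ≤⟨ +-monoˡ-≤ (f i) (dom (length L)) ⟩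
  psum f (length L) + f i        ≤⟨ psum-+-≤ f len<i ⟩
  psum f i                       ≤⟨ bound i ⟩
  sum L                          ≡⟨ +-identityʳ (sum L) ⟨
  sum L + 0                      ∎))
  where open ≤-Reasoning

<⇒≡suc : ∀ {l n} → l < n → ∃[ s ] n ≡ suc s × l ≤ s
<⇒≡suc (s≤s l≤s) = _ , refl , l≤s

crossing-below : ∀ (f : ℕ → ℕ) c l → c < f 1 → f (suc l) ≤ c →
  ∃[ j ] j < l × c < f (suc j) × f (suc (suc j)) ≤ c
crossing-below f c zero    c<f₁ f≤c = ⊥-elim (<⇒≱ c<f₁ f≤c)
crossing-below f c (suc l) c<f₁ f≤c with f (suc l) ≤? c
... | yes f≤c′ = let j , j<l , crossing = crossing-below f c l c<f₁ f≤c′ in j , m<n⇒m<1+n j<l , crossing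
... | no  f≰c′ = l , ≤-refl , ≰⇒> f≰c′ , f≤c

initParts-++-lastPart : ∀ {a} → a ≢ [] → initParts a ++ lastPart a ∷ [] ≡ a
initParts-++-lastPart {[]}         a≢[] = ⊥-elim (a≢[] refl)
initParts-++-lastPart {x ∷ []}     _    = refl
initParts-++-lastPart {x ∷ y ∷ ys} _    = cong (x ∷_) (initParts-++-lastPart {y ∷ ys} (λ ()))

lastPart-++-∷ : ∀ xs y → lastPart (xs ++ y ∷ []) ≡ y
lastPart-++-∷ []           y = refl
lastPart-++-∷ (x ∷ [])     y = refl
lastPart-++-∷ (x ∷ z ∷ zs) y = lastPart-++-∷ (z ∷ zs) y

tilde-≤1 : ∀ a → lastPart a ≤ 1 → tilde a ≡ initParts a
tilde-≤1 a last≤1 with lastPart a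
... | zero     = ++-identityʳ (initParts a)
... | suc zero = ++-identityʳ (initParts a)
tilde-≤1 a (s≤s ()) | suc (suc _)

tilde->1 : ∀ a {c} → lastPart a ≡ suc c → 1 ≤ c → tilde a ≡ initParts a ++ c ∷ []
tilde->1 a last≡ 1≤c with lastPart a
tilde->1 a refl (s≤s z≤n) | suc (suc _) = refl

rhoLemma-≤1 : ∀ μ a l → lastPart a ≤ 1 → rhoLemma μ a l ≡ decAt μ l
rhoLemma-≤1 μ a l last≤1 with lastPart a
... | zero     = refl
... | suc zero = refl
rhoLemma-≤1 μ a l (s≤s ()) | suc (suc _)

rhoLemma->1 : ∀ μ a l → 1 < lastPart a → rhoLemma μ a l ≡ rhoOp (decAt μ l) (tilde a)
rhoLemma->1 μ a l 1<last with lastPart a in last≡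
... | suc (suc _) = cong (λ x → rhoOp (decAt μ l) (initParts a ++ lastDec x)) last≡
rhoLemma->1 μ a l (s≤s ()) | suc zero

module LargeLastPart {μ a : List ℕ} {c : ℕ} (1≤c : 1 ≤ c) (a≢[] : a ≢ []) (last≡ : lastPart a ≡ suc c)
  (μ-desc : Descending μ) (sum≡ : sum μ ≡ sum a) (μ⊵ : μ ⊵ sortDesc a) where

  L : List ℕ
  L = sortDesc (initParts a)

  L-desc : Descending L
  L-desc = sortDesc-descending (initParts a)

  sortDesc-a : sortDesc a ≡ insertDesc (suc c) L
  sortDesc-a = begin
    sortDesc a                                   ≡⟨ cong sortDesc (initParts-++-lastPart a≢[]) ⟨
    sortDesc (initParts a ++ lastPart a ∷ [])    ≡⟨ cong (λ x → sortDesc (initParts a ++ x ∷ [])) last≡ ⟩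
    sortDesc (initParts a ++ suc c ∷ [])         ≡⟨ sortDesc-∷ʳ (initParts a) (suc c) ⟩
    insertDesc (suc c) L                         ∎
    where open ≡-Reasoning

  sortDesc-tilde : sortDesc (tilde a) ≡ insertDesc c L
  sortDesc-tilde = trans (cong sortDesc (tilde->1 a last≡ 1≤c)) (sortDesc-∷ʳ (initParts a) c)

  lastPart-tilde : lastPart (tilde a) ≡ c
  lastPart-tilde = trans (cong lastPart (tilde->1 a last≡ 1≤c)) (lastPart-++-∷ (initParts a) c)

  length-μ-≤ : length μ ≤ length (sortDesc (tilde a))
  length-μ-≤ = begin
    length μ                       ≤⟨ proj₁ μ⊵ ⟩
    length (sortDesc a)            ≡⟨ cong length sortDesc-a ⟩
    length (insertDesc (suc c) L)  ≡⟨ length-insertDesc (suc c) L ⟩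
    suc (length L)                 ≡⟨ length-insertDesc c L ⟨
    length (insertDesc c L)        ≡⟨ cong length sortDesc-tilde ⟨
    length (sortDesc (tilde a))    ∎
    where open ≤-Reasoning

  sum-μ : sum μ ≡ suc c + sum L
  sum-μ = trans sum≡ (trans (sym (sum-sortDesc a)) (trans (cong sum sortDesc-a) (sum-insertDesc (suc c) L)))

  μ-dom : ∀ p → psum (at (insertDesc (suc c) L)) p ≤ psum (at μ) p
  μ-dom = subst (λ t → ∀ p → psum (at t) p ≤ psum (at μ) p) sortDesc-a
    (⊵⇒psum-at-≤ μ⊵ (≤-reflexive (trans (sum-sortDesc a) (sym sum≡))))

  c<μ₁ : c < at μ 1
  c<μ₁ = ≤-trans (psum-+-≤-psum-insertDesc L-desc (suc c) 0) (μ-dom 1)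

  ∈R-at-crossing : ∀ {j} → at μ (suc (suc j)) ≤ c → c < at μ (suc j) → InR μ a (suc j)
  ∈R-at-crossing {j} μ≤c c<μ =
    s≤s z≤n , proj₂ (at-pos⇒index μ (≤-<-trans z≤n c<μ)) , ≤-<-trans μ≤c c<μ ,
    psum-at-≤⇒⊵ (≤-trans (length-decAt-≤ μ j) length-μ-≤)
      (subst (λ t → ∀ p → psum (at t) p ≤ psum (at (decAt μ (suc j))) p) (sym sortDesc-tilde) dom)
    where
    dom : ∀ p → psum (at (insertDesc c L)) p ≤ psum (at (decAt μ (suc j))) p
    dom p with p ≤? j
    ... | yes p≤j = begin
      psum (at (insertDesc c L)) p         ≤⟨ psum-insertDesc-monoˡ L-desc c p ⟩
      psum (at (insertDesc (suc c) L)) p   ≤⟨ μ-dom p ⟩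
      psum (at μ) p                        ≡⟨ psum-decAt-≤ μ j p≤j ⟨
      psum (at (decAt μ (suc j))) p        ∎
      where open ≤-Reasoning
    ... | no  p≰j = +-cancelʳ-≤ 1 _ _ (begin
      psum (at (insertDesc c L)) p + 1     ≡⟨ +-comm _ 1 ⟩
      suc (psum (at (insertDesc c L)) p)   ≤⟨ psum-insertDesc-<-psum L-desc μ-dom μₚ₊₁≤c ⟩
      psum (at μ) p                        ≡⟨ psum-decAt-> μ j (≤-<-trans z≤n c<μ) (≰⇒> p≰j) ⟨
      psum (at (decAt μ (suc j))) p + 1    ∎)
      where
      open ≤-Reasoning
      μₚ₊₁≤c : at μ (suc p) ≤ c
      μₚ₊₁≤c = ≤-trans (at-antitone μ-desc (≰⇒> p≰j)) μ≤c

  c<μ-min : ∀ {l} → IsMinR μ a (suc l) → c < at μ (suc l)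
  c<μ-min {l} (_ , minimal) with c <? at μ (suc l)
  ... | yes c<μ = c<μ
  ... | no  c≮μ with crossing-below (at μ) c l c<μ₁ (≮⇒≥ c≮μ)
  ...   | j , j<l , c<μⱼ , μⱼ₊₁≤c = ⊥-elim (<⇒≱ (s≤s j<l) (minimal (suc j) (∈R-at-crossing μⱼ₊₁≤c c<μⱼ)))

  module Removal {l : ℕ} (step : at μ (suc (suc l)) < at μ (suc l))
    (ν⊵ : decAt μ (suc l) ⊵ sortDesc (tilde a)) (c<μₗ : c < at μ (suc l)) where

    ν : List ℕ
    ν = decAt μ (suc l)

    ρ : List ℕ
    ρ = rhoOp ν (tilde a)

    sum-ν : sum ν ≡ c + sum L
    sum-ν = suc-injective (trans (+-comm 1 (sum ν)) (trans (sum-decAt μ l (≤-<-trans z≤n c<μₗ)) sum-μ))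

    ν-dom : ∀ p → psum (at (insertDesc c L)) p ≤ psum (at ν) p
    ν-dom = subst (λ t → ∀ p → psum (at t) p ≤ psum (at ν) p) sortDesc-tilde
      (⊵⇒psum-at-≤ ν⊵ (≤-reflexive (trans (cong sum sortDesc-tilde) (trans (sum-insertDesc c L) (sym sum-ν)))))

    c≤νₗ : c ≤ at ν (suc l)
    c≤νₗ = subst (c ≤_) (sym (at-decAt-self μ l)) (<⇒≤∸1 c<μₗ)

    l<sIdx : l < sIdx ν c
    l<sIdx = ≮⇒≥ (λ s<l → <⇒≱ (at-<-beyond-sIdx ν c 1≤c s<l) c≤νₗ)

    module _ (s : ℕ) (s≡ : sIdx ν c ≡ suc s) (l≤s : l ≤ s) where

      r : ℕ → ℕ
      r = rhoEntry ν c (suc s)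

      at-ρ : ∀ {i} → 1 ≤ i → at ρ i ≡ r i
      at-ρ {i} 1≤i = begin
        at ρ i                                                   ≡⟨ at-rhoOp ν (tilde a) 1≤i ⟩
        rhoEntry ν (lastPart (tilde a)) (sIdx ν (lastPart (tilde a))) i ≡⟨ cong (λ x → rhoEntry ν x (sIdx ν x) i) lastPart-tilde ⟩
        rhoEntry ν c (sIdx ν c) i                                ≡⟨ cong (λ t → rhoEntry ν c t i) s≡ ⟩
        r i                                                      ∎
        where open ≡-Reasoning

      c≤νₛ : c ≤ at ν (suc s)
      c≤νₛ = subst (λ t → c ≤ at ν t) s≡ (≤-at-sIdx ν c (subst (1 ≤_) (sym s≡) (s≤s z≤n)))

      νₛ₊₁<c : at ν (suc (suc s)) < c
      νₛ₊₁<c = at-<-beyond-sIdx ν c 1≤c (subst (_< suc (suc s)) (sym s≡) ≤-refl)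

      ν≡μ-above : ∀ {i} → suc l < i → at ν i ≡ at μ i
      ν≡μ-above l<i = at-decAt-other μ l (>⇒≢ l<i)

      r≤ν : ∀ {i} → i ≤ suc s → r i ≤ at ν i
      r≤ν i≤ with m≤n⇒m<n∨m≡n i≤
      ... | inj₁ i<s  = ≤-reflexive (rhoEntry-< ν c (suc s) i<s)
      ... | inj₂ refl = rhoEntry-self-≤ ν c≤νₛ (<⇒≤ νₛ₊₁<c)

      r-above : ∀ {i} → suc s < i → r i ≡ at μ (suc i)
      r-above s<i = trans (rhoEntry-> ν c (suc s) s<i) (ν≡μ-above (s≤s (≤-trans (s≤s l≤s) (<⇒≤ s<i))))

      ρ-totallyDisconnected : TotallyDisconnected μ ρ
      ρ-totallyDisconnected = ≤-trans (length-rhoOp-≤ ν (tilde a)) (length-decAt-≤ μ l) , upper , lower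
        where
        upper : ∀ i → 1 ≤ i → i ≤ length ρ → at ρ i ≤ at μ i
        upper (suc i) 1≤i _ rewrite at-ρ 1≤i with suc i ≤? suc s
        ... | yes i≤s = ≤-trans (r≤ν i≤s) (at-decAt-≤ μ l (suc i))
        ... | no  i≰s = ≤-trans (≤-reflexive (r-above (≰⇒> i≰s))) (at-antitone-step μ-desc i)
        lower : ∀ i → 1 ≤ i → i ≤ length ρ → at μ (suc i) ≤ at ρ i
        lower (suc i) 1≤i _ rewrite at-ρ 1≤i with <-cmp (suc i) (suc s)
        ... | tri< i<s _ _ = subst (at μ (suc (suc i)) ≤_) (sym (rhoEntry-< ν c (suc s) i<s))
                                   (at-decAt-lower μ l μ-desc step i)
        ... | tri≈ _ refl _ = subst (_≤ r (suc i)) (ν≡μ-above (s≤s (s≤s l≤s)))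
                                    (≤-rhoEntry-self ν c≤νₛ (<⇒≤ νₛ₊₁<c))
        ... | tri> _ _ s<i = ≤-reflexive (sym (r-above s<i))

      ρₗ<μₗ : at ρ (suc l) < at μ (suc l)
      ρₗ<μₗ = begin-strict
        at ρ (suc l)   ≡⟨ at-ρ (s≤s z≤n) ⟩
        r (suc l)      ≤⟨ r≤ν (s≤s l≤s) ⟩
        at ν (suc l)   <⟨ at-decAt-< μ l (≤-<-trans z≤n c<μₗ) ⟩
        at μ (suc l)   ∎
        where open ≤-Reasoning

      L-dom-r : ∀ p → psum (at L) p ≤ psum r p
      L-dom-r p with p ≤? s
      ... | yes p≤s = begin
        psum (at L) p                 ≤⟨ psum-≤-psum-insertDesc L-desc c p ⟩
        psum (at (insertDesc c L)) p  ≤⟨ ν-dom p ⟩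
        psum (at ν) p                 ≡⟨ psum-rhoEntry-≤ ν c≤νₛ (<⇒≤ νₛ₊₁<c) p≤s ⟨
        psum r p                      ∎
        where open ≤-Reasoning
      ... | no  p≰s = +-cancelʳ-≤ c _ _ (begin
        psum (at L) p + c                    ≤⟨ psum-+-≤-psum-insertDesc L-desc c p ⟩
        psum (at (insertDesc c L)) (suc p)   ≤⟨ ν-dom (suc p) ⟩
        psum (at ν) (suc p)                  ≡⟨ psum-rhoEntry-> ν c≤νₛ (<⇒≤ νₛ₊₁<c) (≰⇒> p≰s) ⟨
        psum r p + c                         ∎)
        where open ≤-Reasoning

      psum-r-≤ : ∀ p → psum r p ≤ sum L
      psum-r-≤ p = +-cancelʳ-≤ c _ _ (begin
        psum r p + c                          ≤⟨ +-monoˡ-≤ c (psum-mono r (m≤m+n p (suc s))) ⟩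
        psum r (p + suc s) + c                ≡⟨ psum-rhoEntry-> ν c≤νₛ (<⇒≤ νₛ₊₁<c) (m≤n+m (suc s) p) ⟩
        psum (at ν) (suc (p + suc s))         ≤⟨ psum-at-≤-sum ν _ ⟩
        sum ν                                 ≡⟨ sum-ν ⟩
        c + sum L                             ≡⟨ +-comm c (sum L) ⟩
        sum L + c                             ∎)
        where open ≤-Reasoning

      ρ⊵L : ρ ⊵ L
      ρ⊵L = psum-at-≤⇒⊵ length-ρ-≤ λ p → subst (psum (at L) p ≤_) (sym (psum-ρ p)) (L-dom-r p)
        where
        psum-ρ : ∀ p → psum (at ρ) p ≡ psum r p
        psum-ρ p = psum-cong p (λ _ _ → at-ρ (s≤s z≤n))
        length-ρ-≤ : length ρ ≤ length L
        length-ρ-≤ = length-rhoOp-≤-vanish ν (tilde a) (length L) λ i L<i →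
          trans (at-ρ (≤-trans (s≤s z≤n) L<i)) (psum-dominated-vanish L r L-dom-r psum-r-≤ L<i)

    properties : TotallyDisconnected μ ρ × at ρ (suc l) < at μ (suc l) × ρ ⊵ L
    properties with <⇒≡suc l<sIdx
    ... | s , s≡ , l≤s = ρ-totallyDisconnected s s≡ l≤s , ρₗ<μₗ s s≡ l≤s , ρ⊵L s s≡ l≤s

lemma4p3 : (n : ℕ) (μ a : List ℕ) → IsPartition μ n → IsComposition a n
    → a ≢ [] → μ ⊵ sortDesc a → (l : ℕ) → IsMinR μ a l
    → TotallyDisconnected μ (rhoLemma μ a l)
      × at (rhoLemma μ a l) l < at μ l
      × rhoLemma μ a l ⊵ sortDesc (initParts a)
lemma4p3 n μ a _ _ _ _ zero ((() , _) , _)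
lemma4p3 n μ a ((_ , sum-μ) , μ-desc) (_ , sum-a) a≢[] μ⊵ (suc l) minR@((_ , _ , step , ν⊵) , _)
  with ≤-<-connex (lastPart a) 1
... | inj₁ last≤1 rewrite rhoLemma-≤1 μ a (suc l) last≤1 =
  decAt-totallyDisconnected μ l μ-desc step ,
  at-decAt-< μ l (≤-<-trans z≤n step) ,
  subst (λ b → decAt μ (suc l) ⊵ sortDesc b) (tilde-≤1 a last≤1) ν⊵
... | inj₂ 1<last with <⇒≡suc 1<last
...   | c , last≡ , 1≤c rewrite rhoLemma->1 μ a (suc l) 1<last =
  Removal.properties step ν⊵ (c<μ-min minR)
  where open LargeLastPart 1≤c a≢[] last≡ μ-desc (trans sum-μ (sym sum-a)) μ⊵
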